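{- Let $Y$ be a finite set, $\mathbb{M}$ a complete MV-chain, $f:\mathbb{M}^Y\to\mathbb{M}^Y$ a monotone function and $H_{\max}$ a max-decomposition of $f$. For every strategy $C$ in $H_{\max}$ the following are equivalent: (1) $\mu f_C$ is not a fixpoint of $f$; (2) $C$ has at least one stable max-improvement; (3) $\mu f_C\sqsubset f(\mu f_C)$.
   Context: An MV-algebra is a tuple $(\mathbb{M},\oplus,0,\overline{(\cdot)})$ where $(\mathbb{M},\oplus,0)$ is a commutative monoid and $\overline{(\cdot)}:\mathbb{M}\to\mathbb{M}$ satisfies, for all $x,y$: $\overline{\overline{x}}=x$, $x\oplus\overline{0}=\overline{0}$, and $\overline{(\overline{x}\oplus y)}\oplus y=\overline{(\overline{y}\oplus x)}\oplus x$. The natural order is $x\sqsubseteq y$ iff $x\oplus z=y$ for some $z\in\mathbb{M}$. An MV-chain is an MV-algebra whose natural order is total; it is complete if it is a complete lattice under the natural order. $\mathbb{M}^Y$ carries the pointwise order; $a\sqsubset b$ means $a\sqsubseteq b$ and $a\neq b$. $\mu g$ denotes the least fixpoint of a monotone endofunction $g$ on a complete lattice. A max-decomposition of $f$ is a map $H_{\max}$ assigning to each $y\in Y$ a finite set $H_{\max}(y)$ of monotone functions $\mathbb{M}^Y\to\mathbb{M}$ such that $f(a)(y)=\max_{h\in H_{\max}(y)}h(a)$ for all $a\in\mathbb{M}^Y$, $y\in Y$. A strategy in $H_{\max}$ is a function $C$ on $Y$ with $C(y)\in H_{\max}(y)$ for all $y$; it induces the monotone map $f_C(a)(y)=C(y)(a)$.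 A strategy $C'$ is a max-improvement of $C$ if $\mu f_C\sqsubset f_{C'}(\mu f_C)$; it is a stable max-improvement if moreover $C'(y)=C(y)$ for every $y\in Y$ with $f_{C'}(\mu f_C)(y)=\mu f_C(y)$. -}

module Defs where

open import Level using (Level; suc; _⊔_)
open import Data.Nat using (ℕ)
open import Data.Fin using (Fin)
open import Data.Product using (Σ; Σ-syntax; ∃; ∃-syntax; _×_; _,_)
open import Data.Sum using (_⊎_)
open import Relation.Nullary using (¬_)
open import Relation.Binary.PropositionalEquality using (_≡_)

record MVAlgebra (c : Level) : Set (suc c) where
  infixl 6 _⊕_
  field
    Carrier : Set c
    _⊕_     : Carrier → Carrier → Carrier
    𝟘       : Carrier
    ‾_      : Carrier → Carrier
    ⊕-assoc    : ∀ x y z → (x ⊕ y) ⊕ z ≡ x ⊕ (y ⊕ z)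
    ⊕-comm     : ∀ x y → x ⊕ y ≡ y ⊕ x
    ⊕-identityʳ : ∀ x → x ⊕ 𝟘 ≡ x
    ‾-involutive : ∀ x → ‾ (‾ x) ≡ x
    ⊕-absorb     : ∀ x → x ⊕ ‾ 𝟘 ≡ ‾ 𝟘
    ŁUK          : ∀ x y → ‾ (‾ x ⊕ y) ⊕ y ≡ ‾ (‾ y ⊕ x) ⊕ x

  _⊑_ : Carrier → Carrier → Set c
  x ⊑ y = Σ[ z ∈ Carrier ] (x ⊕ z ≡ y)

record CompleteMVChain (c : Level) : Set (suc c) where
  field
    mv : MVAlgebra c
  open MVAlgebra mv public
  field
    total    : ∀ x y → x ⊑ y ⊎ y ⊑ x
    sup      : (P : Carrier → Set c) → Carrier
    sup-ub   : (P : Carrier → Set c) → ∀ x → P x → x ⊑ sup P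
    sup-least : (P : Carrier → Set c) → ∀ u → (∀ x → P x → x ⊑ u) → sup P ⊑ u

module _ {c : Level} (M : CompleteMVChain c) (n : ℕ) where
  open CompleteMVChain M

  Vec^ : Set c
  Vec^ = Fin n → Carrier

  _≤̇_ : Vec^ → Vec^ → Set c
  a ≤̇ b = ∀ y → a y ⊑ b y

  _≐_ : Vec^ → Vec^ → Set c
  a ≐ b = ∀ y → a y ≡ b y

  _<̇_ : Vec^ → Vec^ → Set c
  a <̇ b = a ≤̇ b × ¬ (a ≐ b)

  Monotone : (Vec^ → Vec^) → Set c
  Monotone g = ∀ a b → a ≤̇ b → g a ≤̇ g b

  MonotoneComp : (Vec^ → Carrier) → Set c
  MonotoneComp h = ∀ a b → a ≤̇ b → h a ⊑ h b

  IsFixpoint : (Vec^ → Vec^) → Vec^ → Set c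
  IsFixpoint g a = g a ≐ a

  IsLeastFixpoint : (Vec^ → Vec^) → Vec^ → Set c
  IsLeastFixpoint g m = IsFixpoint g m × (∀ a → IsFixpoint g a → m ≤̇ a)

  -- A max-decomposition of f: for each y a finite (indexed) set
  -- H y 0, …, H y (size y - 1) of monotone functions M^Y → M with
  -- f a y = max_i H y i a.
  record MaxDecomposition (f : Vec^ → Vec^) : Set (suc c) where
    field
      size : Fin n → ℕ
      fun  : (y : Fin n) → Fin (size y) → (Vec^ → Carrier)
      fun-mono : ∀ y i → MonotoneComp (fun y i)
      max-attained : ∀ a y → Σ[ i ∈ Fin (size y) ] (fun y i a ≡ f a y)
      max-bound    : ∀ a y (i : Fin (size y)) → fun y i a ⊑ f a y

  module _ {f : Vec^ → Vec^} (H : MaxDecomposition f) where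
    open MaxDecomposition H

    Strategy : Set
    Strategy = (y : Fin n) → Fin (size y)

    fStrat : Strategy → Vec^ → Vec^
    fStrat C a y = fun y (C y) a

    -- C' is a max-improvement of C, where m = μ f_C
    IsMaxImprovement : (C : Strategy) (m : Vec^) (C' : Strategy) → Set c
    IsMaxImprovement C m C' = m <̇ fStrat C' m

    IsStableMaxImprovement : (C : Strategy) (m : Vec^) (C' : Strategy) → Set c
    IsStableMaxImprovement C m C' =
      IsMaxImprovement C m C' × (∀ y → fStrat C' m y ≡ m y → C' y ≡ C y)

-- Since m is a fixpoint of f_C and f is the pointwise maximum of the
-- decomposition, m ⊑ f m always holds; so m fails to be a fixpoint of f
-- exactly when m ⊏ f m. In that case choose a coordinate y₀ where the
-- truncated difference f m y ⊖ m y is maximal (the chain is total and Y is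
-- finite); it is nonzero, so f m y₀ ≠ m y₀. Switching C at y₀ alone to a
-- function attaining the maximum f m y₀ gives a stable max-improvement.
-- Conversely, any max-improvement C′ gives m ⊏ f_C′ m ⊑ f m.
module Submission where

open import Defs
open import Level using (Level)
open import Data.Nat using (ℕ; zero; suc)
open import Data.Fin using (Fin; zero; suc; _≟_)
open import Data.Product using (Σ-syntax; _×_; _,_; proj₁; proj₂)
open import Data.Sum using (inj₁; inj₂)
open import Data.Empty using (⊥-elim)
open import Function using (_∘_)
open import Relation.Nullary using (¬_; yes; no)
open import Relation.Binary.PropositionalEquality
  using (_≡_; refl; sym; trans; cong; subst; module ≡-Reasoning)
open import Function.Bundles using (_⇔_; mk⇔)

module MVChainProperties {c : Level} (M : CompleteMVChain c) where
  open CompleteMVChain M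
  open ≡-Reasoning

  𝟙 : Carrier
  𝟙 = ‾ 𝟘

  ⊑-refl : ∀ x → x ⊑ x
  ⊑-refl x = 𝟘 , ⊕-identityʳ x

  ⊑-trans : ∀ {x y z} → x ⊑ y → y ⊑ z → x ⊑ z
  ⊑-trans {x} (a , refl) (b , refl) = a ⊕ b , sym (⊕-assoc x a b)

  ⊕-identityˡ : ∀ x → 𝟘 ⊕ x ≡ x
  ⊕-identityˡ x = trans (⊕-comm 𝟘 x) (⊕-identityʳ x)

  𝟘-minimum : ∀ x → 𝟘 ⊑ x
  𝟘-minimum x = x , ⊕-identityˡ x

  ‾x⊕x≡𝟙 : ∀ x → ‾ x ⊕ x ≡ 𝟙
  ‾x⊕x≡𝟙 x = begin
    ‾ x ⊕ x                 ≡⟨ cong (λ u → ‾ u ⊕ x) (sym (⊕-identityˡ x)) ⟩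
    ‾ (𝟘 ⊕ x) ⊕ x           ≡⟨ cong (λ u → ‾ (u ⊕ x) ⊕ x) (sym (‾-involutive 𝟘)) ⟩
    ‾ (‾ 𝟙 ⊕ x) ⊕ x         ≡⟨ ŁUK 𝟙 x ⟩
    ‾ (‾ x ⊕ 𝟙) ⊕ 𝟙         ≡⟨ ⊕-absorb _ ⟩
    𝟙                       ∎

  ⊑⇒‾x⊕y≡𝟙 : ∀ {x y} → x ⊑ y → ‾ x ⊕ y ≡ 𝟙
  ⊑⇒‾x⊕y≡𝟙 {x} (a , refl) = begin
    ‾ x ⊕ (x ⊕ a)   ≡⟨ sym (⊕-assoc (‾ x) x a) ⟩
    ‾ x ⊕ x ⊕ a     ≡⟨ cong (_⊕ a) (‾x⊕x≡𝟙 x) ⟩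
    𝟙 ⊕ a           ≡⟨ ⊕-comm 𝟙 a ⟩
    a ⊕ 𝟙           ≡⟨ ⊕-absorb a ⟩
    𝟙               ∎

  -- The left-hand side is the MV-algebra join x ∨ y.
  ⊑⇒join≡ : ∀ {x y} → x ⊑ y → ‾ (‾ x ⊕ y) ⊕ y ≡ y
  ⊑⇒join≡ {x} {y} x⊑y = begin
    ‾ (‾ x ⊕ y) ⊕ y   ≡⟨ cong (λ u → ‾ u ⊕ y) (⊑⇒‾x⊕y≡𝟙 x⊑y) ⟩
    ‾ 𝟙 ⊕ y           ≡⟨ cong (_⊕ y) (‾-involutive 𝟘) ⟩
    𝟘 ⊕ y             ≡⟨ ⊕-identityˡ y ⟩
    y                 ∎

  ⊑-antisym : ∀ {x y} → x ⊑ y → y ⊑ x → x ≡ y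
  ⊑-antisym {x} {y} x⊑y y⊑x = begin
    x                 ≡⟨ sym (⊑⇒join≡ y⊑x) ⟩
    ‾ (‾ y ⊕ x) ⊕ x   ≡⟨ sym (ŁUK x y) ⟩
    ‾ (‾ x ⊕ y) ⊕ y   ≡⟨ ⊑⇒join≡ x⊑y ⟩
    y                 ∎

  ⊑𝟘⇒≡𝟘 : ∀ {x} → x ⊑ 𝟘 → x ≡ 𝟘
  ⊑𝟘⇒≡𝟘 x⊑𝟘 = ⊑-antisym x⊑𝟘 (𝟘-minimum _)

  infixl 6 _⊖_
  _⊖_ : Carrier → Carrier → Carrier
  x ⊖ y = ‾ (‾ x ⊕ y)

  x⊖x≡𝟘 : ∀ x → x ⊖ x ≡ 𝟘
  x⊖x≡𝟘 x = trans (cong ‾_ (‾x⊕x≡𝟙 x)) (‾-involutive 𝟘)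

  x⊖y≡𝟘⇒x⊑y : ∀ {x y} → x ⊖ y ≡ 𝟘 → x ⊑ y
  x⊖y≡𝟘⇒x⊑y {x} {y} x⊖y≡𝟘 = y ⊖ x , (begin
    x ⊕ (y ⊖ x)       ≡⟨ ⊕-comm x _ ⟩
    ‾ (‾ y ⊕ x) ⊕ x   ≡⟨ ŁUK y x ⟩
    (x ⊖ y) ⊕ y       ≡⟨ cong (_⊕ y) x⊖y≡𝟘 ⟩
    𝟘 ⊕ y             ≡⟨ ⊕-identityˡ y ⟩
    y                 ∎)

  argmax : ∀ {k} (g : Fin (suc k) → Carrier) → Σ[ y₀ ∈ Fin (suc k) ] (∀ y → g y ⊑ g y₀)
  argmax {zero} g = zero , λ { zero → ⊑-refl _ }
  argmax {suc k} g with argmax (g ∘ suc)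
  ... | y₁ , g∘suc⊑ with total (g zero) (g (suc y₁))
  ...   | inj₁ g0⊑ = suc y₁ , λ { zero → g0⊑ ; (suc y) → g∘suc⊑ y }
  ...   | inj₂ ⊑g0 = zero , λ { zero → ⊑-refl _ ; (suc y) → ⊑-trans (g∘suc⊑ y) ⊑g0 }

  -- Constructive despite undecidable equality: a maximal value of g is nonzero.
  ¬All≡𝟘⇒nonzero : ∀ {n} (g : Fin n → Carrier) →
                   ¬ (∀ y → g y ≡ 𝟘) → Σ[ y₀ ∈ Fin n ] ¬ (g y₀ ≡ 𝟘)
  ¬All≡𝟘⇒nonzero {zero}  g ¬all = ⊥-elim (¬all λ ())
  ¬All≡𝟘⇒nonzero {suc k} g ¬all with argmax g
  ... | y₀ , ⊑gy₀ = y₀ , λ gy₀≡𝟘 → ¬all λ y → ⊑𝟘⇒≡𝟘 (subst (g y ⊑_) gy₀≡𝟘 (⊑gy₀ y))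

  ≤̇∧≢⇒differsAt : ∀ {n} {a b : Vec^ M n} → _≤̇_ M n a b → ¬ (_≐_ M n b a) →
                  Σ[ y₀ ∈ Fin n ] ¬ (b y₀ ≡ a y₀)
  ≤̇∧≢⇒differsAt {a = a} {b} a≤b b≢a
    with ¬All≡𝟘⇒nonzero (λ y → b y ⊖ a y)
           (λ all≡𝟘 → b≢a λ y → ⊑-antisym (x⊖y≡𝟘⇒x⊑y (all≡𝟘 y)) (a≤b y))
  ... | y₀ , ≢𝟘 = y₀ , λ by₀≡ay₀ → ≢𝟘 (trans (cong (_⊖ a y₀) by₀≡ay₀) (x⊖x≡𝟘 (a y₀)))

module StrategyImprovement {c : Level} (M : CompleteMVChain c) (n : ℕ)
  {f : Vec^ M n → Vec^ M n} (H : MaxDecomposition M n f) where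
  open CompleteMVChain M
  open MaxDecomposition H
  open MVChainProperties M

  fStrat≤̇f : ∀ (C : Strategy M n H) a → _≤̇_ M n (fStrat M n H C a) (f a)
  fStrat≤̇f C a y = max-bound a y (C y)

  module AtFixpoint (C : Strategy M n H) (m : Vec^ M n) (m-fix : IsFixpoint M n (fStrat M n H C) m) where

    fixpoint≤̇f : _≤̇_ M n m (f m)
    fixpoint≤̇f y = subst (_⊑ f m y) (m-fix y) (fStrat≤̇f C m y)

    ¬fixpoint⇔<̇f : (¬ IsFixpoint M n f m) ⇔ _<̇_ M n m (f m)
    ¬fixpoint⇔<̇f = mk⇔ (λ ¬fix → fixpoint≤̇f , ¬fix ∘ symₚ)
                       (λ { (_ , m≢fm) fix → m≢fm (symₚ fix) })
      where
      symₚ : ∀ {a b : Vec^ M n} → _≐_ M n a b → _≐_ M n b a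
      symₚ a≐b y = sym (a≐b y)

    improvement⇒¬fixpoint : ∀ {C′} → IsMaxImprovement M n H C m C′ → ¬ IsFixpoint M n f m
    improvement⇒¬fixpoint {C′} (m≤fC′m , m≢fC′m) fix =
      m≢fC′m λ y → ⊑-antisym (m≤fC′m y) (subst (fStrat M n H C′ m y ⊑_) (fix y) (fStrat≤̇f C′ m y))

    switchAt : Fin n → Strategy M n H
    switchAt y₀ y with y ≟ y₀
    ... | yes _ = proj₁ (max-attained m y)
    ... | no  _ = C y

    switchAt-stable : ∀ y₀ → ¬ (f m y₀ ≡ m y₀) →
                      IsStableMaxImprovement M n H C m (switchAt y₀)
    switchAt-stable y₀ fmy₀≢my₀ = (m≤fC′m , m≢fC′m) , stable
      where
      attains : ∀ y → fun y (proj₁ (max-attained m y)) m ≡ f m y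
      attains y = proj₂ (max-attained m y)

      m≤fC′m : ∀ y → m y ⊑ fStrat M n H (switchAt y₀) m y
      m≤fC′m y with y ≟ y₀
      ... | yes _ = subst (m y ⊑_) (sym (attains y)) (fixpoint≤̇f y)
      ... | no  _ = subst (m y ⊑_) (sym (m-fix y)) (⊑-refl (m y))

      m≢fC′m : ¬ (∀ y → m y ≡ fStrat M n H (switchAt y₀) m y)
      m≢fC′m m≐fC′m with y₀ ≟ y₀ | m≐fC′m y₀
      ... | yes _  | my₀≡ = fmy₀≢my₀ (sym (trans my₀≡ (attains y₀)))
      ... | no y₀≢ | _    = y₀≢ refl

      stable : ∀ y → fStrat M n H (switchAt y₀) m y ≡ m y → switchAt y₀ y ≡ C y
      stable y with y ≟ y₀
      ... | yes refl = λ fC′my≡my → ⊥-elim (fmy₀≢my₀ (trans (sym (attains y)) fC′my≡my))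
      ... | no  _    = λ _ → refl

    ¬fixpoint⇒stableImprovement : ¬ IsFixpoint M n f m →
      Σ[ C′ ∈ Strategy M n H ] IsStableMaxImprovement M n H C m C′
    ¬fixpoint⇒stableImprovement ¬fix =
      let (y₀ , fmy₀≢my₀) = ≤̇∧≢⇒differsAt fixpoint≤̇f ¬fix
      in switchAt y₀ , switchAt-stable y₀ fmy₀≢my₀

mainTheorem8 : ∀ {c : Level} (M : CompleteMVChain c) (n : ℕ)
                 (f : Vec^ M n → Vec^ M n) → Monotone M n f →
                 (H : MaxDecomposition M n f) (C : Strategy M n H) →
                 (m : Vec^ M n) → IsLeastFixpoint M n (fStrat M n H C) m →
                 ((¬ IsFixpoint M n f m) ⇔ (Σ[ C' ∈ Strategy M n H ] IsStableMaxImprovement M n H C m C'))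
                 × ((¬ IsFixpoint M n f m) ⇔ (_<̇_ M n m (f m)))
mainTheorem8 M n f _ H C m (m-fix , _) =
  mk⇔ ¬fixpoint⇒stableImprovement (improvement⇒¬fixpoint ∘ proj₁ ∘ proj₂) ,
  ¬fixpoint⇔<̇f
  where open StrategyImprovement.AtFixpoint M n H C m m-fix
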